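{- (i) For all integers $n\ge4$ and all integers $k$, \begin{align*} E_2(n,k) &= \tfrac{9n^2-9n+2}{2}E_2(n-1,k-3)-\tfrac52E_2(n-1,k-1)+\tfrac{9n^2-36n+35}{2}E_2(n-2,k-4)\\ &\quad+6(n-1)E_2(n-2,k-3)-\tfrac32E_2(n-2,k-2)+3(2n-5)E_2(n-3,k-4)\\ &\quad+\tfrac52E_2(n-3,k-3)+\tfrac52E_2(n-4,k-4). \end{align*} (ii) For all $n\ge4$, $$G_2(n)=\tfrac{9n^2-9n-3}{2}G_2(n-1)+\tfrac{9n^2-24n+20}{2}G_2(n-2)+\left(6n-\tfrac{25}{2}\right)G_2(n-3)+\tfrac52G_2(n-4),$$ and $G_2(0)=1$, $G_2(1)=3$, $G_2(2)=31$, $G_2(3)=842$.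
   Context: For integers $n,k\ge0$, $E_2(n,k)$ is the number of partitions of $\{1,\ldots,k\}$ into exactly $n$ nonempty blocks, each of size at most $3$ ($E_2(0,0)=1$); $E_2(n,k)=0$ if $n$ or $k$ is negative. Gift exchange game with steal limit $\sigma\ge 0$ and $m\ge 1$ gifts: there are $m$ players and $m$ distinct wrapped gifts, initially all in a pool. The players are called one at a time in a fixed order. When a player is called, and also whenever a player's gift has just been stolen, that player (who currently holds no gift) makes a move: either take one of the gifts still in the pool (it is unwrapped and held by that player), or steal an unwrapped gift currently held by another player, provided this gift has so far been stolen fewer than $\sigma$ times in total; the player from whom it was stolen then immediately makes a move. The game ends as soon as the last gift in the pool is taken. A scenario is the complete sequence of moves. For $n\ge 0$, $G_2(n)$ is the number of scenarios of the game with steal limit $\sigma=2$ and $m=n+1$ gifts in which the gifts are taken from the pool in the order $1,2,\ldots,n+1$. -}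

module Defs where

open import Data.Nat using (ℕ; zero; suc; _≤_; _≤?_; _*_; _<?_)
open import Data.Nat.Properties using () renaming (_≟_ to _≟ℕ_)
open import Data.Integer as ℤ using (ℤ; +_; -[1+_])
open import Data.List using (List; []; _∷_; _++_; [_]; map; concatMap; length; filter; upTo)
open import Data.List.Properties using (≡-dec)
open import Data.List.Relation.Unary.All using (All; all?)
open import Data.Product using (_×_; _,_)
open import Relation.Nullary.Decidable using (Dec; yes; no; _×-dec_)
open import Relation.Binary.PropositionalEquality using (_≡_)

picks : {A : Set} → List A → List (A × List A)
picks []       = []
picks (x ∷ xs) = (x , xs) ∷ map (λ { (y , ys) → (y , x ∷ ys) }) (picks xs)

-- setPartitions k : the list of all set partitions of {0,…,k-1}
-- (a relabelling of {1,…,k}), each partition given as a list of its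
-- blocks, each block as a list of its elements.  Generated in the
-- standard way: a partition of {0,…,k} arises uniquely from a partition
-- of {0,…,k-1} by either adding {k} as a new block, or inserting k into
-- one of the existing blocks.

setPartitions : ℕ → List (List (List ℕ))
setPartitions zero    = [ [] ]
setPartitions (suc k) =
  concatMap (λ P → ([ k ] ∷ P) ∷ map (λ { (B , rest) → (k ∷ B) ∷ rest }) (picks P))
            (setPartitions k)

good : ℕ → List (List ℕ) → Set
good n P = (length P ≡ n) × All (λ B → length B ≤ 3) P

good? : (n : ℕ) (P : List (List ℕ)) → Dec (good n P)
good? n P = (length P ≟ℕ n) ×-dec all? (λ B → length B ≤? 3) P

E₂ℕ : ℕ → ℕ → ℕ
E₂ℕ n k = length (filter (good? n) (setPartitions k))

E₂ : ℤ → ℤ → ℤ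
E₂ (+ n)    (+ k)    = + E₂ℕ n k
E₂ (+ n)    -[1+ _ ] = + 0
E₂ -[1+ _ ] _        = + 0

-- Players and gifts are numbered 0,…,m-1.  A move records the player
-- making it and the gift concerned.

data Move : Set where
  take  : (player gift : ℕ) → Move
  steal : (player gift : ℕ) → Move

-- An unwrapped gift: (gift , holder , number of times stolen so far)
Held : Set
Held = ℕ × ℕ × ℕ

-- scenarios σ fuel pool held next active :
-- all complete scenarios (move sequences until the last pool gift is
-- taken) from the given position, where `pool` are the wrapped gifts,
-- `held` the unwrapped ones, `next` the next player to be called and
-- `active` the player (holding no gift) who must move now.
-- The fuel is only for termination: the quantity
-- (σ+1)·|pool| + Σ_{held}(σ - steals) decreases by exactly 1 per move,
-- so fuel m·(σ+1) from the initial position never runs out early.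
scenarios : (σ fuel : ℕ) → List ℕ → List Held → ℕ → ℕ → List (List Move)
scenarios σ zero    pool held nxt p = []
scenarios σ (suc f) pool held nxt p = takes ++ steals
  where
  afterTake : ℕ → List ℕ → List (List Move)
  afterTake g []         = [ take p g ∷ [] ]
  afterTake g pool'@(_ ∷ _) =
    map (take p g ∷_) (scenarios σ f pool' ((g , p , 0) ∷ held) (suc nxt) nxt)
  takes : List (List Move)
  takes = concatMap (λ { (g , pool') → afterTake g pool' }) (picks pool)
  afterSteal : Held → List Held → List (List Move)
  afterSteal (g , h , c) rest with c <? σ
  ... | yes _ = map (steal p g ∷_) (scenarios σ f pool ((g , p , suc c) ∷ rest) nxt h)
  ... | no  _ = []
  steals : List (List Move)
  steals = concatMap (λ { (e , rest) → afterSteal e rest }) (picks held)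

-- all scenarios of the game with steal limit σ and m gifts:
-- all gifts in the pool, player 0 is called first, player 1 is next.
allScenarios : (σ m : ℕ) → List (List Move)
allScenarios σ m = scenarios σ (m * suc σ) (upTo m) [] 1 0

takenOrder : List Move → List ℕ
takenOrder []              = []
takenOrder (take _ g ∷ ms) = g ∷ takenOrder ms
takenOrder (steal _ _ ∷ ms) = takenOrder ms

G₂ : ℕ → ℕ
G₂ n = length (filter (λ s → ≡-dec _≟ℕ_ (takenOrder s) (upTo (suc n))) (allScenarios 2 (suc n)))

module Submission where

-- Both counts are governed by one function.  A state (m , a , b) records m blocks still to be opened,
-- a blocks of size 1 and b blocks of size 2; ways j (m , a , b) counts the sequences of j steps, each
-- opening a new block of size 1 or adding an element to a block of size 1 or 2, after which no block is
-- left to open.  Adding the elements of {1,…,k} one at a time gives E₂(n,k) = ways k (n,0,0).  In the game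
-- a gift stolen c times behaves like a block of size c + 1: with all pool gifts but the last one as the
-- blocks still to open, a take opens a block and a steal grows the stolen gift's block, so
-- G₂(n) = Σⱼ ways j (n,0,0) = Σₖ E₂(n,k).
-- From the first description E₂ satisfies the recurrences "where is the last element" and "mark one
-- block", and (i) is an explicit combination of instances of these two with polynomial multipliers.
-- Summing (i) over k gives the recurrence for G₂.

open import Defs
open import Data.Bool using (Bool; true; false)
open import Data.Nat using (ℕ; _≤_; _∸_)
open import Data.Product using (_×_; _,_)
open import Relation.Binary.PropositionalEquality using (_≡_; refl; trans)

gate : Bool → ℕ → ℕ
gate true  n = n
gate false n = 0

module Ways where

  open import Data.Nat using (zero; suc; pred; _+_; _*_; _≤ᵇ_; _<_)
  open import Data.Nat.Properties using (+-identityʳ; *-zeroʳ; ≤-pred)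
  open import Data.Nat.Tactic.RingSolver using (solve-∀)
  open import Function using (_∘_)
  open import Relation.Binary.PropositionalEquality using (sym; cong; cong₂; subst; _≗_; module ≡-Reasoning)

  State : Set
  State = ℕ × ℕ × ℕ

  Counts : Set
  Counts = State → ℕ

  _⊕_ : Counts → Counts → Counts
  (f ⊕ g) s = f s + g s

  _⊛_ : ℕ → Counts → Counts
  (c ⊛ f) s = c * f s

  infixl 6 _⊕_
  infixl 7 _⊛_

  nothing : Counts
  nothing _ = 0

  done : Counts
  done (zero  , _ , _) = 1
  done (suc _ , _ , _) = 0

  single pair : ℕ → ℕ
  single 1 = 1
  single _ = 0
  pair 2 = 1
  pair _ = 0

  -- The size test is the one `good?` performs, which makes `weight-done` hold by computation.
  afterBlock : ℕ → Counts → Counts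
  afterBlock s f (zero  , a , b) = 0
  afterBlock s f (suc m , a , b) = gate (s ≤ᵇ 3) (f (m , single s + a , pair s + b))

  grow : Counts → Counts
  grow f (m , a , b) = a * f (m , pred a , suc b) + b * f (m , a , pred b)

  step : Counts → Counts
  step f s = afterBlock 1 f s + grow f s

  ways : ℕ → Counts
  ways zero    = done
  ways (suc j) = step (ways j)

  withSingle withPair : Counts → Counts
  withSingle f (m , a , b) = f (m , suc a , b)
  withPair   f (m , a , b) = f (m , a , suc b)

  choose2 : ℕ → ℕ
  choose2 zero    = 0
  choose2 (suc j) = j + choose2 j

  *-suc-pred : ∀ n (g : ℕ → ℕ) → n * g (suc (pred n)) ≡ n * g n
  *-suc-pred zero    g = refl
  *-suc-pred (suc n) g = refl

  gate-zero : ∀ x → gate x 0 ≡ 0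
  gate-zero true  = refl
  gate-zero false = refl

  gate-comm : ∀ x y n → gate x (gate y n) ≡ gate y (gate x n)
  gate-comm true  true  n = refl
  gate-comm true  false n = refl
  gate-comm false true  n = refl
  gate-comm false false n = refl

  gate-+ : ∀ x p q → gate x (p + q) ≡ gate x p + gate x q
  gate-+ true  p q = refl
  gate-+ false p q = refl

  gate-* : ∀ x c p → gate x (c * p) ≡ c * gate x p
  gate-* true  c p = refl
  gate-* false c p = sym (*-zeroʳ c)

  afterBlock-cong : ∀ s {f g} → f ≗ g → afterBlock s f ≗ afterBlock s g
  afterBlock-cong s eq (zero  , a , b) = refl
  afterBlock-cong s eq (suc m , a , b) = cong (gate (s ≤ᵇ 3)) (eq _)

  afterBlock-⊕ : ∀ s f g → afterBlock s (f ⊕ g) ≗ afterBlock s f ⊕ afterBlock s g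
  afterBlock-⊕ s f g (zero  , a , b) = refl
  afterBlock-⊕ s f g (suc m , a , b) = gate-+ (s ≤ᵇ 3) _ _

  afterBlock-⊛ : ∀ s c f → afterBlock s (c ⊛ f) ≗ c ⊛ afterBlock s f
  afterBlock-⊛ s c f (zero  , a , b) = sym (*-zeroʳ c)
  afterBlock-⊛ s c f (suc m , a , b) = gate-* (s ≤ᵇ 3) c _

  afterBlock-comm : ∀ s t f → afterBlock s (afterBlock t f) ≗ afterBlock t (afterBlock s f)
  afterBlock-comm s t f (zero , a , b)        = refl
  afterBlock-comm s t f (suc zero , a , b)    = trans (gate-zero (s ≤ᵇ 3)) (sym (gate-zero (t ≤ᵇ 3)))
  afterBlock-comm s t f (suc (suc m) , a , b) =
    trans (gate-comm (s ≤ᵇ 3) (t ≤ᵇ 3) _)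
          (cong (gate (t ≤ᵇ 3) ∘ gate (s ≤ᵇ 3))
                (cong₂ (λ a′ b′ → f (m , a′ , b′)) (swap (single t) (single s) a) (swap (pair t) (pair s) b)))
    where
    swap : ∀ x y z → x + (y + z) ≡ y + (x + z)
    swap = solve-∀

  grow-nothing : grow nothing ≗ nothing
  grow-nothing (m , a , b) = vanish a b
    where
    vanish : ∀ a b → a * 0 + b * 0 ≡ 0
    vanish = solve-∀

  step-cong : ∀ {f g} → f ≗ g → step f ≗ step g
  step-cong eq s@(m , a , b) =
    cong₂ _+_ (afterBlock-cong 1 eq s) (cong₂ _+_ (cong (a *_) (eq _)) (cong (b *_) (eq _)))

  step-nothing : step nothing ≗ nothing
  step-nothing (zero  , a , b) = grow-nothing (zero , a , b)
  step-nothing (suc m , a , b) = grow-nothing (suc m , a , b)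

  step-⊕ : ∀ f g → step (f ⊕ g) ≗ step f ⊕ step g
  step-⊕ f g s@(m , a , b) =
    trans (cong₂ _+_ (afterBlock-⊕ 1 f g s) refl) (distrib (afterBlock 1 f s) (afterBlock 1 g s) a b _ _ _ _)
    where
    distrib : ∀ x y a b p q r t → x + y + (a * (p + q) + b * (r + t)) ≡ x + (a * p + b * r) + (y + (a * q + b * t))
    distrib = solve-∀

  step-⊛ : ∀ c f → step (c ⊛ f) ≗ c ⊛ step f
  step-⊛ c f s@(m , a , b) =
    trans (cong₂ _+_ (afterBlock-⊛ 1 c f s) refl) (distrib c (afterBlock 1 f s) a b _ _)
    where
    distrib : ∀ c x a b p q → c * x + (a * (c * p) + b * (c * q)) ≡ c * (x + (a * p + b * q))
    distrib = solve-∀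

  peel-single : ∀ x w a (g : ℕ → ℕ) → x + (suc a * g a + w) ≡ x + (a * g (suc (pred a)) + w) + g a
  peel-single x w a g = begin
    x + (suc a * g a + w)                ≡⟨ shuffle x w (g a) (a * g a) ⟩
    x + (a * g a + w) + g a              ≡⟨ cong (λ t → x + (t + w) + g a) (sym (*-suc-pred a g)) ⟩
    x + (a * g (suc (pred a)) + w) + g a ∎
    where
    open ≡-Reasoning
    shuffle : ∀ x w y z → x + (y + z + w) ≡ x + (z + w) + y
    shuffle = solve-∀

  peel-pair : ∀ x y b (g : ℕ → ℕ) → x + (y + suc b * g b) ≡ x + (y + b * g (suc (pred b))) + g b
  peel-pair x y b g = begin
    x + (y + suc b * g b)                ≡⟨ shuffle x y (g b) (b * g b) ⟩
    x + (y + b * g b) + g b              ≡⟨ cong (λ t → x + (y + t) + g b) (sym (*-suc-pred b g)) ⟩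
    x + (y + b * g (suc (pred b))) + g b ∎
    where
    open ≡-Reasoning
    shuffle : ∀ x y w z → x + (y + (w + z)) ≡ x + (y + z) + w
    shuffle = solve-∀

  withPair-step : ∀ f → withPair (step f) ≗ step (withPair f) ⊕ f
  withPair-step f (zero  , a , b) =
    peel-pair 0 (a * f (zero , pred a , suc (suc b))) b (λ t → f (zero , a , t))
  withPair-step f (suc m , a , b) =
    peel-pair (f (m , suc a , suc b)) (a * f (suc m , pred a , suc (suc b))) b (λ t → f (suc m , a , t))

  withSingle-step : ∀ f → withSingle (step f) ≗ step (withSingle f) ⊕ withPair f
  withSingle-step f (zero  , a , b) =
    peel-single 0 (b * f (zero , suc a , pred b)) a (λ t → f (zero , t , suc b))
  withSingle-step f (suc m , a , b) =
    peel-single (f (m , suc (suc a) , b)) (b * f (suc m , suc a , pred b)) a (λ t → f (suc m , t , suc b))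

  -- A step either leaves the freshly opened block alone or adds an element to it.
  afterBlock-step : ∀ s f → afterBlock (suc s) (step f) ≗ step (afterBlock (suc s) f) ⊕ afterBlock (suc (suc s)) f
  afterBlock-step s f (zero , a , b) = sym (trans (+-identityʳ _) (grow-nothing (zero , a , b)))
  afterBlock-step zero f (suc m , a , b) =
    peel-single (afterBlock 1 f (m , suc a , b)) (b * f (m , suc a , pred b)) a (λ t → f (m , t , suc b))
  afterBlock-step 1 f (suc zero , a , b) =
    peel-pair 0 (a * f (zero , pred a , suc (suc b))) b (λ t → f (zero , a , t))
  afterBlock-step 1 f (suc (suc m) , a , b) =
    peel-pair (f (m , suc a , suc b)) (a * f (suc m , pred a , suc (suc b))) b (λ t → f (suc m , a , t))
  afterBlock-step 2 f (suc zero , a , b)     = sym (+-identityʳ _)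
  afterBlock-step 2 f (suc (suc m) , a , b)  = sym (+-identityʳ _)
  afterBlock-step (suc (suc (suc s))) f (suc zero , a , b) =
    sym (trans (+-identityʳ _) (grow-nothing (suc zero , a , b)))
  afterBlock-step (suc (suc (suc s))) f (suc (suc m) , a , b) =
    sym (trans (+-identityʳ _) (grow-nothing (suc (suc m) , a , b)))

  *-step-ways-pred : ∀ j s → j * step (ways (pred j)) s ≡ j * ways j s
  *-step-ways-pred zero    s = refl
  *-step-ways-pred (suc j) s = refl

  *-step-ways-pred₂ : ∀ j s → choose2 j * step (ways (pred (pred j))) s ≡ choose2 j * ways (pred j) s
  *-step-ways-pred₂ zero          s = refl
  *-step-ways-pred₂ (suc zero)    s = refl
  *-step-ways-pred₂ (suc (suc j)) s = refl

  ways-withPair : ∀ j → withPair (ways j) ≗ ways j ⊕ j ⊛ ways (pred j)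
  ways-withPair zero    (zero  , a , b) = refl
  ways-withPair zero    (suc m , a , b) = refl
  ways-withPair (suc j) s = begin
    withPair (step (ways j)) s                              ≡⟨ withPair-step (ways j) s ⟩
    step (withPair (ways j)) s + ways j s                   ≡⟨ cong (_+ ways j s) (step-cong (ways-withPair j) s) ⟩
    step (ways j ⊕ j ⊛ ways (pred j)) s + ways j s         ≡⟨ cong (_+ ways j s) (step-⊕ (ways j) _ s) ⟩
    step (ways j) s + step (j ⊛ ways (pred j)) s + ways j s
      ≡⟨ cong (λ t → step (ways j) s + t + ways j s) (trans (step-⊛ j _ s) (*-step-ways-pred j s)) ⟩
    ways (suc j) s + j * ways j s + ways j s                ≡⟨ collect (ways (suc j) s) j (ways j s) ⟩
    ways (suc j) s + suc j * ways j s                       ∎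
    where
    open ≡-Reasoning
    collect : ∀ x j w → x + j * w + w ≡ x + suc j * w
    collect = solve-∀

  ways-withSingle : ∀ j → withSingle (ways j) ≗ ways j ⊕ j ⊛ ways (pred j) ⊕ choose2 j ⊛ ways (pred (pred j))
  ways-withSingle zero    (zero  , a , b) = refl
  ways-withSingle zero    (suc m , a , b) = refl
  ways-withSingle (suc j) s = begin
    withSingle (step (ways j)) s
      ≡⟨ withSingle-step (ways j) s ⟩
    step (withSingle (ways j)) s + withPair (ways j) s
      ≡⟨ cong₂ _+_ (step-cong (ways-withSingle j) s) (ways-withPair j s) ⟩
    step (ways j ⊕ j ⊛ w₁ ⊕ choose2 j ⊛ w₂) s + (ways j s + j * w₁ s)
      ≡⟨ cong (_+ (ways j s + j * w₁ s))
              (trans (step-⊕ (ways j ⊕ j ⊛ w₁) _ s) (cong (_+ step (choose2 j ⊛ w₂) s) (step-⊕ (ways j) _ s))) ⟩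
    step (ways j) s + step (j ⊛ w₁) s + step (choose2 j ⊛ w₂) s + (ways j s + j * w₁ s)
      ≡⟨ cong₂ (λ x y → step (ways j) s + x + y + (ways j s + j * w₁ s))
               (trans (step-⊛ j w₁ s) (*-step-ways-pred j s)) (trans (step-⊛ (choose2 j) w₂ s) (*-step-ways-pred₂ j s)) ⟩
    ways (suc j) s + j * ways j s + choose2 j * w₁ s + (ways j s + j * w₁ s)
      ≡⟨ collect (ways (suc j) s) j (choose2 j) (ways j s) (w₁ s) ⟩
    ways (suc j) s + suc j * ways j s + (j + choose2 j) * w₁ s ∎
    where
    open ≡-Reasoning
    w₁ w₂ : Counts
    w₁ = ways (pred j)
    w₂ = ways (pred (pred j))
    collect : ∀ x j c w v → x + j * w + c * v + (w + j * v) ≡ x + suc j * w + (j + c) * v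
    collect = solve-∀

  ∑ᶜ : ℕ → (ℕ → Counts) → Counts
  ∑ᶜ zero    f = nothing
  ∑ᶜ (suc F) f = f 0 ⊕ ∑ᶜ F (f ∘ suc)

  step-∑ᶜ : ∀ F f → step (∑ᶜ F f) ≗ ∑ᶜ F (step ∘ f)
  step-∑ᶜ zero    f s = step-nothing s
  step-∑ᶜ (suc F) f s = trans (step-⊕ (f 0) (∑ᶜ F (f ∘ suc)) s) (cong (step (f 0) s +_) (step-∑ᶜ F (f ∘ suc) s))

  within : ℕ → Counts
  within F = ∑ᶜ F ways

  within-suc : ∀ F → within (suc F) ≗ done ⊕ step (within F)
  within-suc F s = cong (done s +_) (sym (step-∑ᶜ F ways s))

  -- Every step lowers the potential by exactly one.
  potential : State → ℕ
  potential (m , a , b) = b + 2 * a + 3 * m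

  ways-beyond : ∀ j s → potential s < j → ways j s ≡ 0
  ways-beyond zero    s ()
  ways-beyond (suc j) (m , a , b) lt = cong₂ _+_ (opening m lt) (cong₂ _+_ (fromSingle a lt) (fromPair b lt))
    where
    smaller : ∀ s′ s → suc (potential s′) ≡ potential s → potential s < suc j → potential s′ < j
    smaller s′ s eq lt = subst (_≤ j) (sym eq) (≤-pred lt)
    opening : ∀ m → potential (m , a , b) < suc j → afterBlock 1 (ways j) (m , a , b) ≡ 0
    opening zero    lt = refl
    opening (suc m) lt = ways-beyond j (m , suc a , b) (smaller (m , suc a , b) (suc m , a , b) (balance b a m) lt)
      where
      balance : ∀ b a m → suc (b + 2 * suc a + 3 * m) ≡ b + 2 * a + 3 * suc m
      balance = solve-∀
    fromSingle : ∀ a → potential (m , a , b) < suc j → a * ways j (m , pred a , suc b) ≡ 0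
    fromSingle zero    lt = refl
    fromSingle (suc a) lt =
      trans (cong (suc a *_) (ways-beyond j (m , a , suc b) (smaller (m , a , suc b) (m , suc a , b) (balance b a m) lt)))
            (*-zeroʳ (suc a))
      where
      balance : ∀ b a m → suc (suc b + 2 * a + 3 * m) ≡ b + 2 * suc a + 3 * m
      balance = solve-∀
    fromPair : ∀ b → potential (m , a , b) < suc j → b * ways j (m , a , pred b) ≡ 0
    fromPair zero    lt = refl
    fromPair (suc b) lt =
      trans (cong (suc b *_) (ways-beyond j (m , a , b) (smaller (m , a , b) (m , a , suc b) refl lt))) (*-zeroʳ (suc b))

module Lists where

  open import Data.Nat using (suc; _+_)
  open import Data.Nat.ListAction using (sum)
  open import Data.Nat.ListAction.Properties using (sum-++)
  open import Data.List using (List; []; _∷_; _++_; map; concatMap; length; filter)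
  open import Data.List.Properties using (map-++; map-∘)
  open import Data.List.Relation.Unary.All as All using (All; []; _∷_)
  open import Data.List.Relation.Unary.All.Properties using (map⁺)
  open import Data.Product using (proj₁)
  open import Function using (_∘_)
  open import Level using (0ℓ)
  open import Relation.Nullary using (does)
  open import Relation.Unary using (Pred; Decidable)
  open import Relation.Binary.PropositionalEquality using (sym; cong; cong₂; module ≡-Reasoning)

  private variable
    A B C : Set

  sum-map-cong : ∀ {f g : A → ℕ} xs → (∀ x → f x ≡ g x) → sum (map f xs) ≡ sum (map g xs)
  sum-map-cong []       eq = refl
  sum-map-cong (x ∷ xs) eq = cong₂ _+_ (eq x) (sum-map-cong xs eq)

  sum-map-congᴬ : ∀ {P : Pred A 0ℓ} {f g : A → ℕ} {xs} → All P xs → (∀ {x} → P x → f x ≡ g x) →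
    sum (map f xs) ≡ sum (map g xs)
  sum-map-congᴬ []       eq = refl
  sum-map-congᴬ (p ∷ ps) eq = cong₂ _+_ (eq p) (sum-map-congᴬ ps eq)

  sum-map-∘ : ∀ (f : B → ℕ) (g : C → B) xs → sum (map f (map g xs)) ≡ sum (map (f ∘ g) xs)
  sum-map-∘ f g xs = cong sum (sym (map-∘ xs))

  sum-zero : ∀ {f : A → ℕ} {xs} → All (λ x → f x ≡ 0) xs → sum (map f xs) ≡ 0
  sum-zero []       = refl
  sum-zero (z ∷ zs) = cong₂ _+_ z (sum-zero zs)

  sum-concatMap : ∀ (h : B → ℕ) (g : A → List B) xs →
    sum (map h (concatMap g xs)) ≡ sum (map (λ x → sum (map h (g x))) xs)
  sum-concatMap h g []       = refl
  sum-concatMap h g (x ∷ xs) = begin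
    sum (map h (g x ++ concatMap g xs))              ≡⟨ cong sum (map-++ h (g x) _) ⟩
    sum (map h (g x) ++ map h (concatMap g xs))      ≡⟨ sum-++ (map h (g x)) _ ⟩
    sum (map h (g x)) + sum (map h (concatMap g xs)) ≡⟨ cong (sum (map h (g x)) +_) (sum-concatMap h g xs) ⟩
    sum (map h (g x)) + sum (map (λ x → sum (map h (g x))) xs) ∎
    where open ≡-Reasoning

  length-filter : ∀ {P : Pred A 0ℓ} (P? : Decidable P) xs → length (filter P? xs) ≡ sum (map (λ x → gate (does (P? x)) 1) xs)
  length-filter P? []       = refl
  length-filter P? (x ∷ xs) with does (P? x)
  ... | true  = cong suc (length-filter P? xs)
  ... | false = length-filter P? xs

  All-picks-picked : ∀ {P : Pred A 0ℓ} {xs} → All P xs → All (P ∘ proj₁) (picks xs)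
  All-picks-picked []       = []
  All-picks-picked (p ∷ ps) = p ∷ map⁺ (All-picks-picked ps)

  All-picks-rest : ∀ {P : Pred A 0ℓ} {xs} → All P xs → All (λ (_ , rest) → All P rest) (picks xs)
  All-picks-rest []       = []
  All-picks-rest (p ∷ ps) = ps ∷ map⁺ (All.map (p ∷_) (All-picks-rest ps))

module Partitions where

  open Ways
  open Lists
  open import Data.Bool using (_∧_)
  open import Data.Nat using (zero; suc; pred; _+_; _*_; _≤ᵇ_; _≡ᵇ_; _<_; s≤s; z≤n)
  open import Data.Nat.Properties using (+-identityʳ; +-suc)
  open import Data.Nat.ListAction using (sum)
  open import Data.Nat.Tactic.RingSolver using (solve-∀)
  open import Data.List using (List; []; _∷_; [_]; map; concatMap; length; filter)
  open import Data.List.Relation.Unary.All as All using (All; []; _∷_)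
  open import Data.List.Relation.Unary.All.Properties using (map⁺; concat⁺)
  open import Function using (_∘_)
  open import Relation.Nullary using (does)
  open import Relation.Binary.PropositionalEquality using (sym; cong; cong₂; _≗_; module ≡-Reasoning)

  Partition : Set
  Partition = List (List ℕ)

  NonEmptyBlocks : Partition → Set
  NonEmptyBlocks = All (λ B → 0 < length B)

  weight : Counts → Partition → Counts
  weight f []      = f
  weight f (B ∷ P) = weight (afterBlock (length B) f) P

  weight-cong : ∀ P {f g} → f ≗ g → weight f P ≗ weight g P
  weight-cong []      eq = eq
  weight-cong (B ∷ P) eq = weight-cong P (afterBlock-cong (length B) eq)

  weight-⊕ : ∀ P f g → weight (f ⊕ g) P ≗ weight f P ⊕ weight g P
  weight-⊕ []      f g s = refl
  weight-⊕ (B ∷ P) f g s =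
    trans (weight-cong P (afterBlock-⊕ (length B) f g) s) (weight-⊕ P (afterBlock (length B) f) _ s)

  weight-afterBlock : ∀ P s f → weight (afterBlock s f) P ≗ afterBlock s (weight f P)
  weight-afterBlock []      s f st = refl
  weight-afterBlock (B ∷ P) s f st =
    trans (weight-cong P (afterBlock-comm (length B) s f) st) (weight-afterBlock P s (afterBlock (length B) f) st)

  extensions : ℕ → Partition → List Partition
  extensions k P = ([ k ] ∷ P) ∷ map (λ (B , rest) → (k ∷ B) ∷ rest) (picks P)

  setPartitions-suc : ∀ k → setPartitions (suc k) ≡ concatMap (extensions k) (setPartitions k)
  setPartitions-suc k = refl

  nonEmptyBlocks : ∀ k → All NonEmptyBlocks (setPartitions k)
  nonEmptyBlocks zero    = [] ∷ []
  nonEmptyBlocks (suc k) = concat⁺ (map⁺ (All.map extend (nonEmptyBlocks k)))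
    where
    extend : ∀ {P} → NonEmptyBlocks P → All NonEmptyBlocks (extensions k P)
    extend ne = (s≤s z≤n ∷ ne) ∷ map⁺ (All.map (s≤s z≤n ∷_) (All-picks-rest ne))

  -- A new element either forms a block of size 1 or joins a block; weights with a block of size > 3 vanish.
  weight-extensions : ∀ k n P → NonEmptyBlocks P → ∀ f →
    sum (map (λ P′ → weight f P′ (n , 0 , 0)) (extensions k P)) ≡ weight (step f) P (n , 0 , 0)
  weight-extensions k n []            []       f = refl
  weight-extensions k n ((x ∷ B) ∷ Q) (_ ∷ ne) f = begin
    h f ([ k ] ∷ (x ∷ B) ∷ Q) + (h f ((k ∷ x ∷ B) ∷ Q) + sum (map (h f) (map insert (map moveBack (picks Q)))))
      ≡⟨ cong₂ (λ u v → u + (h f ((k ∷ x ∷ B) ∷ Q) + v))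
               (weight-cong Q (afterBlock-comm (suc (length B)) 1 f) s₀) reorder ⟩
    h g ([ k ] ∷ Q) + (h f ((k ∷ x ∷ B) ∷ Q) + sum (map (h g) (map insert (picks Q))))
      ≡⟨ rotate (h g ([ k ] ∷ Q)) (h f ((k ∷ x ∷ B) ∷ Q)) _ ⟩
    h g ([ k ] ∷ Q) + sum (map (h g) (map insert (picks Q))) + h f ((k ∷ x ∷ B) ∷ Q)
      ≡⟨ cong (_+ h f ((k ∷ x ∷ B) ∷ Q)) (weight-extensions k n Q ne g) ⟩
    weight (step g) Q s₀ + weight (afterBlock (suc (suc (length B))) f) Q s₀
      ≡⟨ weight-⊕ Q (step g) _ s₀ ⟨
    weight (step g ⊕ afterBlock (suc (suc (length B))) f) Q s₀
      ≡⟨ weight-cong Q (afterBlock-step (length B) f) s₀ ⟨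
    weight (step f) ((x ∷ B) ∷ Q) s₀ ∎
    where
    open ≡-Reasoning
    s₀ = (n , 0 , 0)
    g = afterBlock (suc (length B)) f
    h : Counts → Partition → ℕ
    h f P = weight f P s₀
    insert : List ℕ × Partition → Partition
    insert (y , ys) = (k ∷ y) ∷ ys
    moveBack : List ℕ × Partition → List ℕ × Partition
    moveBack (y , ys) = (y , (x ∷ B) ∷ ys)
    reorder : sum (map (h f) (map insert (map moveBack (picks Q)))) ≡ sum (map (h g) (map insert (picks Q)))
    reorder = begin
      sum (map (h f) (map insert (map moveBack (picks Q)))) ≡⟨ sum-map-∘ (h f) insert (map moveBack (picks Q)) ⟩
      sum (map (h f ∘ insert) (map moveBack (picks Q)))   ≡⟨ sum-map-∘ (h f ∘ insert) moveBack (picks Q) ⟩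
      sum (map (h f ∘ insert ∘ moveBack) (picks Q))
        ≡⟨ sum-map-cong (picks Q) (λ (y , ys) → weight-cong ys (afterBlock-comm (suc (length B)) (suc (length y)) f) s₀) ⟩
      sum (map (h g ∘ insert) (picks Q))                  ≡⟨ sum-map-∘ (h g) insert (picks Q) ⟨
      sum (map (h g) (map insert (picks Q)))              ∎
    rotate : ∀ u v w → u + (v + w) ≡ u + w + v
    rotate = solve-∀

  weight-setPartitions : ∀ k j n →
    sum (map (λ P → weight (ways j) P (n , 0 , 0)) (setPartitions k)) ≡ ways (k + j) (n , 0 , 0)
  weight-setPartitions zero    j n = +-identityʳ (ways j (n , 0 , 0))
  weight-setPartitions (suc k) j n = begin
    sum (map (h j) (setPartitions (suc k)))
      ≡⟨ cong (sum ∘ map (h j)) (setPartitions-suc k) ⟩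
    sum (map (h j) (concatMap (extensions k) (setPartitions k)))
      ≡⟨ sum-concatMap (h j) (extensions k) (setPartitions k) ⟩
    sum (map (λ P → sum (map (h j) (extensions k P))) (setPartitions k))
      ≡⟨ sum-map-congᴬ (nonEmptyBlocks k) (λ {P} ne → weight-extensions k n P ne (ways j)) ⟩
    sum (map (h (suc j)) (setPartitions k))
      ≡⟨ weight-setPartitions k (suc j) n ⟩
    ways (k + suc j) s₀
      ≡⟨ cong (λ i → ways i s₀) (+-suc k j) ⟩
    ways (suc k + j) s₀ ∎
    where
    open ≡-Reasoning
    s₀ = (n , 0 , 0)
    h : ℕ → Partition → ℕ
    h j P = weight (ways j) P s₀

  gate-∧ : ∀ x y z → gate y (gate (x ∧ z) 1) ≡ gate (x ∧ (y ∧ z)) 1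
  gate-∧ x     true  z = refl
  gate-∧ true  false z = refl
  gate-∧ false false z = refl

  weight-done : ∀ P → NonEmptyBlocks P → ∀ m a b → weight done P (m , a , b) ≡ gate (does (good? m P)) 1
  weight-done []            []       zero    a b = refl
  weight-done []            []       (suc m) a b = refl
  weight-done ((x ∷ B) ∷ Q) (_ ∷ ne) m       a b =
    trans (weight-afterBlock Q (suc (length B)) done (m , a , b)) (firstBlock m)
    where
    firstBlock : ∀ m → afterBlock (suc (length B)) (weight done Q) (m , a , b) ≡ gate (does (good? m ((x ∷ B) ∷ Q))) 1
    firstBlock zero    = refl
    firstBlock (suc m) = trans (cong (gate (suc (length B) ≤ᵇ 3)) (weight-done Q ne m _ _))
                               (gate-∧ (length Q ≡ᵇ m) (suc (length B) ≤ᵇ 3) _)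

  E₂ℕ-ways : ∀ n k → E₂ℕ n k ≡ ways k (n , 0 , 0)
  E₂ℕ-ways n k = begin
    length (filter (good? n) (setPartitions k))                  ≡⟨ length-filter (good? n) (setPartitions k) ⟩
    sum (map (λ P → gate (does (good? n P)) 1) (setPartitions k))
      ≡⟨ sum-map-congᴬ (nonEmptyBlocks k) (λ {P} ne → sym (weight-done P ne n 0 0)) ⟩
    sum (map (λ P → weight done P (n , 0 , 0)) (setPartitions k)) ≡⟨ weight-setPartitions k 0 n ⟩
    ways (k + 0) (n , 0 , 0)                                     ≡⟨ cong (λ i → ways i (n , 0 , 0)) (+-identityʳ k) ⟩
    ways k (n , 0 , 0)                                           ∎
    where open ≡-Reasoning

  E₂ℕ-lastBlock : ∀ m k → E₂ℕ (suc m) (suc k) ≡ E₂ℕ m k + k * E₂ℕ m (pred k) + choose2 k * E₂ℕ m (pred (pred k))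
  E₂ℕ-lastBlock m k
    rewrite E₂ℕ-ways (suc m) (suc k) | E₂ℕ-ways m k | E₂ℕ-ways m (pred k) | E₂ℕ-ways m (pred (pred k)) =
    trans (+-identityʳ _) (ways-withSingle k (m , 0 , 0))

module GiftExchange where

  open Ways
  open Lists
  open import Data.Nat using (zero; suc; pred; _+_; _*_)
  open import Data.Nat.Properties using (_≟_; +-comm; +-identityʳ; +-assoc)
  open import Data.Nat.ListAction using (sum)
  open import Data.List using (List; []; _∷_; [_]; _++_; map; concatMap; length; filter; applyUpTo)
  open import Data.List.Properties using (≡-dec; filter-++; length-++; filter-none; ∷-injectiveˡ; ∷-injectiveʳ; length-applyUpTo)
  open import Data.List.Relation.Unary.All as All using (All; []; _∷_)
  open import Data.List.Relation.Unary.All.Properties using (map⁺)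
  open import Data.List.Relation.Unary.AllPairs using (_∷_)
  open import Data.List.Relation.Unary.Unique.Propositional using (Unique)
  open import Data.List.Relation.Unary.Unique.Propositional.Properties using (upTo⁺)
  open import Function using (_∘_; mk⇔)
  open import Relation.Nullary using (Dec; does)
  open import Relation.Nullary.Decidable using (does-⇔)
  open import Relation.Binary.PropositionalEquality using (_≢_; sym; cong; cong₂; module ≡-Reasoning)

  inOrder : (pool : List ℕ) (s : List Move) → Dec (takenOrder s ≡ pool)
  inOrder pool s = ≡-dec _≟_ (takenOrder s) pool

  count : List ℕ → List (List Move) → ℕ
  count pool ss = length (filter (inOrder pool) ss)

  count-++ : ∀ pool ss ts → count pool (ss ++ ts) ≡ count pool ss + count pool ts
  count-++ pool ss ts = trans (cong length (filter-++ (inOrder pool) ss ts)) (length-++ (filter (inOrder pool) ss))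

  count-concatMap : ∀ {A : Set} pool (g : A → List (List Move)) xs → count pool (concatMap g xs) ≡ sum (map (count pool ∘ g) xs)
  count-concatMap pool g []       = refl
  count-concatMap pool g (x ∷ xs) = trans (count-++ pool (g x) _) (cong (count pool (g x) +_) (count-concatMap pool g xs))

  count-map : ∀ {pool pool′} (f : List Move → List Move) → (∀ s → does (inOrder pool (f s)) ≡ does (inOrder pool′ s)) →
    ∀ ss → count pool (map f ss) ≡ count pool′ ss
  count-map f eq []       = refl
  count-map {pool} {pool′} f eq (s ∷ ss) with does (inOrder pool (f s)) | does (inOrder pool′ s) | eq s
  ... | true  | true  | refl = cong suc (count-map f eq ss)
  ... | false | false | refl = count-map f eq ss

  count-take-front : ∀ p x xs ss → count (x ∷ xs) (map (take p x ∷_) ss) ≡ count xs ss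
  count-take-front p x xs = count-map (take p x ∷_)
    (λ s → does-⇔ (mk⇔ ∷-injectiveʳ (cong (x ∷_))) (inOrder (x ∷ xs) (take p x ∷ s)) (inOrder xs s))

  count-take-other : ∀ p g x xs → g ≢ x → ∀ ss → count (x ∷ xs) (map (take p g ∷_) ss) ≡ 0
  count-take-other p g x xs g≢x ss =
    cong length (filter-none (inOrder (x ∷ xs)) (map⁺ (All.universal (λ s → g≢x ∘ ∷-injectiveˡ) ss)))

  count-steal : ∀ p g pool ss → count pool (map (steal p g ∷_) ss) ≡ count pool ss
  count-steal p g pool = count-map (steal p g ∷_) (λ s → refl)

  unstolen stolenOnce : List Held → ℕ
  unstolen []                     = 0
  unstolen ((_ , _ , zero) ∷ hs)  = suc (unstolen hs)
  unstolen ((_ , _ , suc _) ∷ hs) = unstolen hs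
  stolenOnce []                 = 0
  stolenOnce ((_ , _ , 1) ∷ hs) = suc (stolenOnce hs)
  stolenOnce (_ ∷ hs)           = stolenOnce hs

  -- With pool x ∷ xs, taking x ends the game exactly when xs is empty; that last take is counted by `done`.
  position : List ℕ → List Held → State
  position xs held = (length xs , unstolen held , stolenOnce held)

  sum-steals : ∀ (f : Counts) m (v : Held → List Held → ℕ) →
    (∀ g h rest → v (g , h , 0) rest ≡ f (m , unstolen rest , suc (stolenOnce rest))) →
    (∀ g h rest → v (g , h , 1) rest ≡ f (m , unstolen rest , stolenOnce rest)) →
    (∀ g h c rest → v (g , h , suc (suc c)) rest ≡ 0) →
    ∀ held → sum (map (λ (e , rest) → v e rest) (picks held)) ≡ grow f (m , unstolen held , stolenOnce held)
  sum-steals f m v v₀ v₁ v₂ []       = refl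
  sum-steals f m v v₀ v₁ v₂ (e ∷ hs) =
    trans (cong (v e hs +_) (sum-map-∘ (λ (e′ , rest) → v e′ rest) (λ (e′ , rest) → (e′ , e ∷ rest)) (picks hs)))
          (picked e)
    where
    a = unstolen hs
    b = stolenOnce hs
    picked : ∀ e → v e hs + sum (map (λ (e′ , rest) → v e′ (e ∷ rest)) (picks hs))
                   ≡ grow f (m , unstolen (e ∷ hs) , stolenOnce (e ∷ hs))
    picked (g , h , zero) = begin
      v (g , h , 0) hs + _
        ≡⟨ cong₂ _+_ (v₀ g h hs)
                     (sum-steals (withSingle f) m _ (λ g′ h′ → v₀ g′ h′ ∘ (_ ∷_)) (λ g′ h′ → v₁ g′ h′ ∘ (_ ∷_))
                                 (λ g′ h′ c′ → v₂ g′ h′ c′ ∘ (_ ∷_)) hs) ⟩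
      f (m , a , suc b) + grow (withSingle f) (m , a , b)
        ≡⟨ +-comm (f (m , a , suc b)) _ ⟩
      grow (withSingle f) (m , a , b) + f (m , a , suc b)
        ≡⟨ peel-single 0 (b * f (m , suc a , pred b)) a (λ t → f (m , t , suc b)) ⟨
      grow f (m , suc a , b) ∎
      where open ≡-Reasoning
    picked (g , h , suc zero) = begin
      v (g , h , 1) hs + _
        ≡⟨ cong₂ _+_ (v₁ g h hs)
                     (sum-steals (withPair f) m _ (λ g′ h′ → v₀ g′ h′ ∘ (_ ∷_)) (λ g′ h′ → v₁ g′ h′ ∘ (_ ∷_))
                                 (λ g′ h′ c′ → v₂ g′ h′ c′ ∘ (_ ∷_)) hs) ⟩
      f (m , a , b) + grow (withPair f) (m , a , b)
        ≡⟨ +-comm (f (m , a , b)) _ ⟩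
      grow (withPair f) (m , a , b) + f (m , a , b)
        ≡⟨ peel-pair 0 (a * f (m , pred a , suc (suc b))) b (λ t → f (m , a , t)) ⟨
      grow f (m , a , suc b) ∎
      where open ≡-Reasoning
    picked (g , h , suc (suc c)) =
      cong₂ _+_ (v₂ g h c hs)
                (sum-steals f m _ (λ g′ h′ → v₀ g′ h′ ∘ (_ ∷_)) (λ g′ h′ → v₁ g′ h′ ∘ (_ ∷_))
                            (λ g′ h′ c′ → v₂ g′ h′ c′ ∘ (_ ∷_)) hs)

  InOrderCount : ℕ → Set
  InOrderCount F = ∀ x xs held nxt p → Unique (x ∷ xs) →
    count (x ∷ xs) (scenarios 2 F (x ∷ xs) held nxt p) ≡ within F (position xs held)

  -- The two branches of `scenarios` are local definitions in Defs; `firstMove` recovers them by unification.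
  record FirstMove (F : ℕ) (pool : List ℕ) (held : List Held) (nxt p : ℕ) : Set where
    field
      afterTake   : ℕ × List ℕ → List (List Move)
      afterSteal  : Held × List Held → List (List Move)
      unfold      : scenarios 2 (suc F) pool held nxt p ≡ concatMap afterTake (picks pool) ++ concatMap afterSteal (picks held)
      takeLast    : ∀ g → afterTake (g , []) ≡ [ [ take p g ] ]
      takeAnother : ∀ g y ys → afterTake (g , y ∷ ys) ≡ map (take p g ∷_) (scenarios 2 F (y ∷ ys) ((g , p , 0) ∷ held) (suc nxt) nxt)
      stealFresh  : ∀ g h rest → afterSteal ((g , h , 0) , rest) ≡ map (steal p g ∷_) (scenarios 2 F pool ((g , p , 1) ∷ rest) nxt h)
      stealOnce   : ∀ g h rest → afterSteal ((g , h , 1) , rest) ≡ map (steal p g ∷_) (scenarios 2 F pool ((g , p , 2) ∷ rest) nxt h)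
      stealFrozen : ∀ g h c rest → afterSteal ((g , h , suc (suc c)) , rest) ≡ []

  firstMove : ∀ F pool held nxt p → FirstMove F pool held nxt p
  firstMove F pool held nxt p = record
    { unfold = refl ; takeLast = λ _ → refl ; takeAnother = λ _ _ _ → refl
    ; stealFresh = λ _ _ _ → refl ; stealOnce = λ _ _ _ → refl ; stealFrozen = λ _ _ _ _ → refl }

  count-scenarios-suc : ∀ {F x xs held nxt p} → FirstMove F (x ∷ xs) held nxt p → InOrderCount F → Unique (x ∷ xs) →
    count (x ∷ xs) (scenarios 2 (suc F) (x ∷ xs) held nxt p) ≡ within (suc F) (position xs held)
  count-scenarios-suc {F} {x} {xs} {held} {nxt} {p} M ih u@(x∉xs ∷ uxs) = begin
    count pool (scenarios 2 (suc F) pool held nxt p)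
      ≡⟨ cong (count pool) unfold ⟩
    count pool (concatMap T (picks pool) ++ concatMap S (picks held))
      ≡⟨ count-++ pool (concatMap T (picks pool)) (concatMap S (picks held)) ⟩
    count pool (concatMap T (picks pool)) + count pool (concatMap S (picks held))
      ≡⟨ cong₂ _+_ (count-concatMap pool T (picks pool)) (count-concatMap pool S (picks held)) ⟩
    count pool (T (x , xs)) + sum (map (count pool ∘ T) (map (λ (y , ys) → (y , x ∷ ys)) (picks xs)))
      + sum (map (count pool ∘ S) (picks held))
      ≡⟨ cong₂ (λ t u → count pool (T (x , xs)) + t + u) otherTakes steals ⟩
    count pool (T (x , xs)) + 0 + grow (within F) pos
      ≡⟨ cong (_+ grow (within F) pos) (trans (+-identityʳ _) (frontTake xs uxs)) ⟩
    done pos + afterBlock 1 (within F) pos + grow (within F) pos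
      ≡⟨ +-assoc (done pos) _ _ ⟩
    done pos + step (within F) pos
      ≡⟨ within-suc F pos ⟨
    within (suc F) pos ∎
    where
    open FirstMove M renaming (afterTake to T; afterSteal to S)
    open ≡-Reasoning
    pool = x ∷ xs
    pos = position xs held
    frontTake : ∀ xs → Unique xs → count (x ∷ xs) (T (x , xs)) ≡ done (position xs held) + afterBlock 1 (within F) (position xs held)
    frontTake []       _  = trans (cong (count (x ∷ [])) (takeLast x)) (count-take-front p x [] [ [] ])
    frontTake (y ∷ ys) u′ = begin
      count (x ∷ y ∷ ys) (T (x , y ∷ ys))                           ≡⟨ cong (count (x ∷ y ∷ ys)) (takeAnother x y ys) ⟩
      count (x ∷ y ∷ ys) (map (take p x ∷_) later)                  ≡⟨ count-take-front p x (y ∷ ys) later ⟩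
      count (y ∷ ys) later                                          ≡⟨ ih y ys ((x , p , 0) ∷ held) (suc nxt) nxt u′ ⟩
      within F (position ys ((x , p , 0) ∷ held))                   ∎
      where
      later = scenarios 2 F (y ∷ ys) ((x , p , 0) ∷ held) (suc nxt) nxt
    otherTakes : sum (map (count pool ∘ T) (map (λ (y , ys) → (y , x ∷ ys)) (picks xs))) ≡ 0
    otherTakes = trans (sum-map-∘ (count pool ∘ T) (λ (y , ys) → (y , x ∷ ys)) (picks xs))
      (sum-zero (All.map (λ {(y , ys)} x≢y → trans (cong (count pool) (takeAnother y x ys))
                                               (count-take-other p y x xs (x≢y ∘ sym) (scenarios 2 F (x ∷ ys) ((y , p , 0) ∷ held) (suc nxt) nxt)))
                         (All-picks-picked x∉xs)))
    stolenAgain : ∀ g h c rest → S ((g , h , c) , rest) ≡ map (steal p g ∷_) (scenarios 2 F pool ((g , p , suc c) ∷ rest) nxt h) →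
      count pool (S ((g , h , c) , rest)) ≡ within F (position xs ((g , p , suc c) ∷ rest))
    stolenAgain g h c rest eq =
      trans (cong (count pool) eq)
            (trans (count-steal p g pool (scenarios 2 F pool ((g , p , suc c) ∷ rest) nxt h)) (ih x xs ((g , p , suc c) ∷ rest) nxt h u))
    steals : sum (map (count pool ∘ S) (picks held)) ≡ grow (within F) pos
    steals = sum-steals (within F) (length xs) (λ e rest → count pool (S (e , rest)))
      (λ g h rest → stolenAgain g h 0 rest (stealFresh g h rest))
      (λ g h rest → stolenAgain g h 1 rest (stealOnce g h rest))
      (λ g h c rest → cong (count pool) (stealFrozen g h c rest))
      held

  scenarios-inOrder : ∀ F → InOrderCount F
  scenarios-inOrder zero    x xs held nxt p u = refl
  scenarios-inOrder (suc F) x xs held nxt p u =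
    count-scenarios-suc (firstMove F (x ∷ xs) held nxt p) (scenarios-inOrder F) u

  G₂-within : ∀ n → G₂ n ≡ within (suc n * 3) (n , 0 , 0)
  G₂-within n = trans (scenarios-inOrder (suc n * 3) 0 (applyUpTo suc n) [] 1 0 (upTo⁺ (suc n)))
                      (cong (λ m → within (suc n * 3) (m , 0 , 0)) (length-applyUpTo suc n))

module Recurrences where

  open Ways using (ways; choose2)
  open Partitions using (E₂ℕ-ways; E₂ℕ-lastBlock)
  import Data.Nat as ℕ
  import Data.Nat.Properties as ℕ
  open import Data.Nat using (zero; suc; pred)
  open import Data.Integer using (ℤ; +_; -[1+_]; _+_; _-_; _*_; -_)
  open import Data.Integer.Properties using (pos-+; pos-*; +-assoc; neg-distrib-+; i≡j⇒i-j≡0; i-j≡0⇒i≡j; *-cancelˡ-≡; *-zeroʳ)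
  open import Data.Integer.Tactic.RingSolver using (solve-∀)
  open import Relation.Binary.PropositionalEquality using (sym; cong; cong₂; module ≡-Reasoning)

  E₂-ways : ∀ n k → E₂ (+ n) (+ k) ≡ + ways k (n , 0 , 0)
  E₂-ways n k = cong +_ (E₂ℕ-ways n k)

  choose2-double : ∀ k → + 2 * + choose2 k ≡ + k * (+ k - + 1)
  choose2-double zero    = refl
  choose2-double (suc k) = begin
    + 2 * + (k ℕ.+ choose2 k)       ≡⟨ cong (+ 2 *_) (pos-+ k (choose2 k)) ⟩
    + 2 * (+ k + + choose2 k)       ≡⟨ distrib (+ k) (+ choose2 k) ⟩
    + 2 * + k + + 2 * + choose2 k   ≡⟨ cong (_+_ (+ 2 * + k)) (choose2-double k) ⟩
    + 2 * + k + + k * (+ k - + 1)   ≡⟨ shift (+ k) ⟩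
    + suc k * (+ suc k - + 1)       ∎
    where
    open ≡-Reasoning
    distrib : ∀ a b → + 2 * (a + b) ≡ + 2 * a + + 2 * b
    distrib = solve-∀
    shift : ∀ a → + 2 * a + a * (a - + 1) ≡ (+ 1 + a) * (+ 1 + a - + 1)
    shift = solve-∀

  E₂-lastBlock-suc : ∀ m k → + 2 * E₂ (+ suc m) (+ suc k) ≡
    + 2 * E₂ (+ m) (+ k) + + 2 * + k * E₂ (+ m) (+ pred k) + + k * (+ k - + 1) * E₂ (+ m) (+ pred (pred k))
  E₂-lastBlock-suc m k = begin
    + 2 * E₂ (+ suc m) (+ suc k)                           ≡⟨ cong (λ t → + 2 * + t) (E₂ℕ-lastBlock m k) ⟩
    + 2 * + (x ℕ.+ k ℕ.* y ℕ.+ choose2 k ℕ.* z)            ≡⟨ cong (+ 2 *_) lift ⟩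
    + 2 * (+ x + + k * + y + + choose2 k * + z)            ≡⟨ distrib (+ x) (+ k) (+ y) (+ choose2 k) (+ z) ⟩
    + 2 * + x + + 2 * + k * + y + + 2 * + choose2 k * + z  ≡⟨ cong (λ c → + 2 * + x + + 2 * + k * + y + c * + z) (choose2-double k) ⟩
    + 2 * + x + + 2 * + k * + y + + k * (+ k - + 1) * + z  ∎
    where
    open ≡-Reasoning
    x = E₂ℕ m k
    y = E₂ℕ m (pred k)
    z = E₂ℕ m (pred (pred k))
    lift : + (x ℕ.+ k ℕ.* y ℕ.+ choose2 k ℕ.* z) ≡ + x + + k * + y + + choose2 k * + z
    lift = trans (pos-+ (x ℕ.+ k ℕ.* y) _) (cong₂ _+_ (trans (pos-+ x _) (cong (_+_ (+ x)) (pos-* k y))) (pos-* (choose2 k) z))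
    distrib : ∀ x k y c z → + 2 * (x + k * y + c * z) ≡ + 2 * x + + 2 * k * y + + 2 * c * z
    distrib = solve-∀

  E₂-lastBlock : ∀ m k → + 2 * E₂ (+ suc m) k ≡
    + 2 * E₂ (+ m) (k - + 1) + + 2 * (k - + 1) * E₂ (+ m) (k - + 2) + (k - + 1) * (k - + 2) * E₂ (+ m) (k - + 3)
  E₂-lastBlock m -[1+ j ]               = vanish (-[1+ j ] - + 1) (-[1+ j ] - + 2)
    where
    vanish : ∀ c d → + 0 ≡ + 2 * + 0 + + 2 * c * + 0 + c * d * + 0
    vanish = solve-∀
  E₂-lastBlock m (+ zero)                = refl
  E₂-lastBlock m (+ suc zero)            = E₂-lastBlock-suc m 0
  E₂-lastBlock m (+ suc (suc zero))      = E₂-lastBlock-suc m 1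
  E₂-lastBlock m (+ suc (suc (suc k)))   = E₂-lastBlock-suc m (suc (suc k))

  k-s-t≡k-[s+t] : ∀ k s t → k - + s - + t ≡ k - + (s ℕ.+ t)
  k-s-t≡k-[s+t] k s t = trans (+-assoc k (- + s) (- + t)) (cong (_+_ k) (sym (neg-distrib-+ (+ s) (+ t))))

  E₂-lastBlock-at : ∀ m k s → + 2 * E₂ (+ suc m) (k - + s) ≡
    + 2 * E₂ (+ m) (k - + (s ℕ.+ 1)) + + 2 * (k - + s - + 1) * E₂ (+ m) (k - + (s ℕ.+ 2))
    + (k - + s - + 1) * (k - + s - + 2) * E₂ (+ m) (k - + (s ℕ.+ 3))
  E₂-lastBlock-at m k s rewrite sym (k-s-t≡k-[s+t] k s 1) | sym (k-s-t≡k-[s+t] k s 2) | sym (k-s-t≡k-[s+t] k s 3) =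
    E₂-lastBlock m (k - + s)

  infix  5 _·_
  infixl 4 _⊹_·_

  data ZeroCombination : ℤ → Set where
    _·_   : ∀ {g} (c : ℤ) → g ≡ + 0 → ZeroCombination (c * g)
    _⊹_·_ : ∀ {s g} → ZeroCombination s → (c : ℤ) → g ≡ + 0 → ZeroCombination (s + c * g)

  zeroCombination : ∀ {s} → ZeroCombination s → s ≡ + 0
  zeroCombination (c · refl)     = *-zeroʳ c
  zeroCombination (z ⊹ c · refl) = cong₂ _+_ (zeroCombination z) (*-zeroʳ c)

  2[a-b]≡0⇒a≡b : ∀ a b → + 2 * (a - b) ≡ + 0 → a ≡ b
  2[a-b]≡0⇒a≡b a b eq = i-j≡0⇒i≡j a b (*-cancelˡ-≡ (+ 2) (a - b) (+ 0) eq)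

  -- `last j` and `mark m j` are the differences of the two sides of E₂-lastBlock and E₂-markedBlock
  -- at k = j, and eᵢₛ stands for E₂ (m − i) (k − s).
  markedBlock-identity : ∀ (m k e₀₀ e₁₁ e₁₂ e₁₃ e₂₂ e₂₃ e₂₄ e₂₅ e₂₆ : ℤ) →
    let last : ℤ → ℤ → ℤ → ℤ → ℤ → ℤ
        last j x₀ x₁ x₂ x₃ = + 2 * x₀ - (+ 2 * x₁ + + 2 * (j - + 1) * x₂ + (j - + 1) * (j - + 2) * x₃)
        mark : ℤ → ℤ → ℤ → ℤ → ℤ → ℤ → ℤ
        mark m j x₀ x₁ x₂ x₃ = + 6 * m * x₀ - (+ 6 * j * x₁ + + 3 * j * (j - + 1) * x₂ + j * (j - + 1) * (j - + 2) * x₃)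
    in  + 2 * mark m k e₀₀ e₁₁ e₁₂ e₁₃ ≡
          (+ 2 - + 3 * k + k * k)             * mark (m - + 1) (k - + 3) e₁₃ e₂₄ e₂₅ e₂₆
        + (+ 2 * k - + 2)                     * mark (m - + 1) (k - + 2) e₁₂ e₂₃ e₂₄ e₂₅
        + + 2                                 * mark (m - + 1) (k - + 1) e₁₁ e₂₂ e₂₃ e₂₄
        + (+ 6 - + 11 * k + + 6 * k * k - k * k * k) * last (k - + 3) e₁₃ e₂₄ e₂₅ e₂₆
        + (+ 9 * k - + 6 - + 3 * k * k)       * last (k - + 2) e₁₂ e₂₃ e₂₄ e₂₅
        + (+ 6 - + 6 * k)                     * last (k - + 1) e₁₁ e₂₂ e₂₃ e₂₄
        + + 6 * m                             * last k e₀₀ e₁₁ e₁₂ e₁₃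
  markedBlock-identity = solve-∀

  markedBlock-rhs-zero : ∀ k {x y z} → x ≡ + 0 → y ≡ + 0 → z ≡ + 0 →
    + 6 * k * x + + 3 * k * (k - + 1) * y + k * (k - + 1) * (k - + 2) * z ≡ + 0
  markedBlock-rhs-zero k refl refl refl = vanish k
    where
    vanish : ∀ k → + 6 * k * + 0 + + 3 * k * (k - + 1) * + 0 + k * (k - + 1) * (k - + 2) * + 0 ≡ + 0
    vanish = solve-∀

  E₂-markedBlock : ∀ m k → + 6 * + m * E₂ (+ m) k ≡
    + 6 * k * E₂ (+ m - + 1) (k - + 1) + + 3 * k * (k - + 1) * E₂ (+ m - + 1) (k - + 2)
    + k * (k - + 1) * (k - + 2) * E₂ (+ m - + 1) (k - + 3)

  E₂-markedBlock-at : ∀ m k s → + 6 * + m * E₂ (+ m) (k - + s) ≡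
    + 6 * (k - + s) * E₂ (+ m - + 1) (k - + (s ℕ.+ 1)) + + 3 * (k - + s) * (k - + s - + 1) * E₂ (+ m - + 1) (k - + (s ℕ.+ 2))
    + (k - + s) * (k - + s - + 1) * (k - + s - + 2) * E₂ (+ m - + 1) (k - + (s ℕ.+ 3))
  E₂-markedBlock-at m k s rewrite sym (k-s-t≡k-[s+t] k s 1) | sym (k-s-t≡k-[s+t] k s 2) | sym (k-s-t≡k-[s+t] k s 3) =
    E₂-markedBlock m (k - + s)

  E₂-markedBlock zero       k        = sym (markedBlock-rhs-zero k refl refl refl)
  E₂-markedBlock (suc zero) -[1+ j ] = sym (markedBlock-rhs-zero -[1+ j ] refl refl refl)
  E₂-markedBlock (suc zero) (+ 0)    = refl
  E₂-markedBlock (suc zero) (+ 1)    = refl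
  E₂-markedBlock (suc zero) (+ 2)    = refl
  E₂-markedBlock (suc zero) (+ 3)    = refl
  E₂-markedBlock (suc zero) (+ suc (suc (suc (suc j)))) =
    trans (cong (+ 6 * + 1 *_) (E₂-ways 1 (4 ℕ.+ j)))
          (sym (markedBlock-rhs-zero (+ (4 ℕ.+ j)) (E₂-ways 0 (3 ℕ.+ j)) (E₂-ways 0 (2 ℕ.+ j)) (E₂-ways 0 (1 ℕ.+ j))))
  E₂-markedBlock (suc (suc m)) k = 2[a-b]≡0⇒a≡b _ _ (trans
    (markedBlock-identity (+ suc (suc m)) k (E₂ (+ suc (suc m)) k)
      (e 1 1) (e 1 2) (e 1 3) (e 2 2) (e 2 3) (e 2 4) (e 2 5) (e 2 6))
    (zeroCombination
      ( + 2 - + 3 * k + k * k                   · i≡j⇒i-j≡0 (E₂-markedBlock-at (suc m) k 3)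
      ⊹ + 2 * k - + 2                           · i≡j⇒i-j≡0 (E₂-markedBlock-at (suc m) k 2)
      ⊹ + 2                                     · i≡j⇒i-j≡0 (E₂-markedBlock-at (suc m) k 1)
      ⊹ + 6 - + 11 * k + + 6 * k * k - k * k * k · i≡j⇒i-j≡0 (E₂-lastBlock-at m k 3)
      ⊹ + 9 * k - + 6 - + 3 * k * k             · i≡j⇒i-j≡0 (E₂-lastBlock-at m k 2)
      ⊹ + 6 - + 6 * k                           · i≡j⇒i-j≡0 (E₂-lastBlock-at m k 1)
      ⊹ + 6 * + suc (suc m)                     · i≡j⇒i-j≡0 (E₂-lastBlock (suc m) k))))
    where
    e : ℕ → ℕ → ℤ
    e i s = E₂ (+ suc (suc m) - + i) (k - + s)

  -- Here eᵢₛ stands for E₂ (n − i) (k − s).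
  recurrence-identity : ∀ (n k e₀₀ e₁₁ e₁₂ e₁₃ e₂₂ e₂₃ e₂₄ e₂₅ e₂₆ : ℤ) (e₃₃ e₃₄ e₃₅ e₃₆ e₃₇ e₄₄ e₄₅ e₄₆ e₄₇ e₄₈ : ℤ) →
    let last : ℤ → ℤ → ℤ → ℤ → ℤ → ℤ
        last j x₀ x₁ x₂ x₃ = + 2 * x₀ - (+ 2 * x₁ + + 2 * (j - + 1) * x₂ + (j - + 1) * (j - + 2) * x₃)
        mark : ℤ → ℤ → ℤ → ℤ → ℤ → ℤ → ℤ
        mark m j x₀ x₁ x₂ x₃ = + 6 * m * x₀ - (+ 6 * j * x₁ + + 3 * j * (j - + 1) * x₂ + j * (j - + 1) * (j - + 2) * x₃)
    in  + 2 * (+ 2 * e₀₀ - ((+ 9 * n * n - + 9 * n + + 2) * e₁₃ - + 5 * e₁₁ + (+ 9 * n * n - + 36 * n + + 35) * e₂₄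
                           + + 12 * (n - + 1) * e₂₃ - + 3 * e₂₂ + + 6 * (+ 2 * n - + 5) * e₃₄ + + 5 * e₃₃ + + 5 * e₄₄)) ≡
          (+ 4 - k)                                        * mark (n - + 3) (k - + 5) e₃₅ e₄₆ e₄₇ e₄₈
        + - + 3                                            * mark (n - + 3) (k - + 4) e₃₄ e₄₅ e₄₆ e₄₇
        + (+ 13 - + 2 * k - + 3 * n)                       * mark (n - + 2) (k - + 4) e₂₄ e₃₅ e₃₆ e₃₇
        + - + 4                                            * mark (n - + 2) (k - + 3) e₂₃ e₃₄ e₃₅ e₃₆
        + (+ 3 - k - + 3 * n)                              * mark (n - + 1) (k - + 3) e₁₃ e₂₄ e₂₅ e₂₆
        + - + 1                                            * mark (n - + 1) (k - + 2) e₁₂ e₂₃ e₂₄ e₂₅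
        + (+ 20 - + 9 * k + k * k)                         * last (k - + 5) e₃₅ e₄₆ e₄₇ e₄₈
        + (+ 4 * k - + 16)                                 * last (k - + 4) e₃₄ e₄₅ e₄₆ e₄₇
        + + 5                                              * last (k - + 3) e₃₃ e₄₄ e₄₅ e₄₆
        + (+ 52 - + 21 * k + + 2 * k * k - + 12 * n + + 3 * n * k) * last (k - + 4) e₂₄ e₃₅ e₃₆ e₃₇
        + (+ 6 * k + + 3 * n - + 25)                       * last (k - + 3) e₂₃ e₃₄ e₃₅ e₃₆
        + + 10                                             * last (k - + 2) e₂₂ e₃₃ e₃₄ e₃₅
        + (+ 9 - + 6 * k + k * k - + 9 * n + + 3 * n * k)  * last (k - + 3) e₁₃ e₂₄ e₂₅ e₂₆
        + (+ 2 * k + + 3 * n - + 5)                        * last (k - + 2) e₁₂ e₂₃ e₂₄ e₂₅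
        + + 7                                              * last (k - + 1) e₁₁ e₂₂ e₂₃ e₂₄
        + + 2                                              * last k e₀₀ e₁₁ e₁₂ e₁₃
  recurrence-identity = solve-∀

  E₂-recurrence : (n : ℕ) → 4 ℕ.≤ n → (k : ℤ) →
        + 2 * E₂ (+ n) k ≡
            (+ 9 * + n * + n - + 9 * + n + + 2) * E₂ (+ n - + 1) (k - + 3)
          - + 5 * E₂ (+ n - + 1) (k - + 1)
          + (+ 9 * + n * + n - + 36 * + n + + 35) * E₂ (+ n - + 2) (k - + 4)
          + + 12 * (+ n - + 1) * E₂ (+ n - + 2) (k - + 3)
          - + 3 * E₂ (+ n - + 2) (k - + 2)
          + + 6 * (+ 2 * + n - + 5) * E₂ (+ n - + 3) (k - + 4)
          + + 5 * E₂ (+ n - + 3) (k - + 3)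
          + + 5 * E₂ (+ n - + 4) (k - + 4)
  E₂-recurrence n@(suc (suc (suc (suc m)))) _ k = 2[a-b]≡0⇒a≡b _ _ (trans
    (recurrence-identity (+ n) k (E₂ (+ n) k)
      (e 1 1) (e 1 2) (e 1 3) (e 2 2) (e 2 3) (e 2 4) (e 2 5) (e 2 6)
      (e 3 3) (e 3 4) (e 3 5) (e 3 6) (e 3 7) (e 4 4) (e 4 5) (e 4 6) (e 4 7) (e 4 8))
    (zeroCombination
      ( + 4 - k                                          · i≡j⇒i-j≡0 (E₂-markedBlock-at (1 ℕ.+ m) k 5)
      ⊹ - + 3                                            · i≡j⇒i-j≡0 (E₂-markedBlock-at (1 ℕ.+ m) k 4)
      ⊹ + 13 - + 2 * k - + 3 * + n                       · i≡j⇒i-j≡0 (E₂-markedBlock-at (2 ℕ.+ m) k 4)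
      ⊹ - + 4                                            · i≡j⇒i-j≡0 (E₂-markedBlock-at (2 ℕ.+ m) k 3)
      ⊹ + 3 - k - + 3 * + n                              · i≡j⇒i-j≡0 (E₂-markedBlock-at (3 ℕ.+ m) k 3)
      ⊹ - + 1                                            · i≡j⇒i-j≡0 (E₂-markedBlock-at (3 ℕ.+ m) k 2)
      ⊹ + 20 - + 9 * k + k * k                           · i≡j⇒i-j≡0 (E₂-lastBlock-at m k 5)
      ⊹ + 4 * k - + 16                                   · i≡j⇒i-j≡0 (E₂-lastBlock-at m k 4)
      ⊹ + 5                                              · i≡j⇒i-j≡0 (E₂-lastBlock-at m k 3)
      ⊹ + 52 - + 21 * k + + 2 * k * k - + 12 * + n + + 3 * + n * k · i≡j⇒i-j≡0 (E₂-lastBlock-at (1 ℕ.+ m) k 4)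
      ⊹ + 6 * k + + 3 * + n - + 25                       · i≡j⇒i-j≡0 (E₂-lastBlock-at (1 ℕ.+ m) k 3)
      ⊹ + 10                                             · i≡j⇒i-j≡0 (E₂-lastBlock-at (1 ℕ.+ m) k 2)
      ⊹ + 9 - + 6 * k + k * k - + 9 * + n + + 3 * + n * k · i≡j⇒i-j≡0 (E₂-lastBlock-at (2 ℕ.+ m) k 3)
      ⊹ + 2 * k + + 3 * + n - + 5                        · i≡j⇒i-j≡0 (E₂-lastBlock-at (2 ℕ.+ m) k 2)
      ⊹ + 7                                              · i≡j⇒i-j≡0 (E₂-lastBlock-at (2 ℕ.+ m) k 1)
      ⊹ + 2                                              · i≡j⇒i-j≡0 (E₂-lastBlock (3 ℕ.+ m) k))))
    where
    e : ℕ → ℕ → ℤ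
    e i s = E₂ (+ n - + i) (k - + s)
  E₂-recurrence 1 (ℕ.s≤s ()) k
  E₂-recurrence 2 (ℕ.s≤s (ℕ.s≤s ())) k
  E₂-recurrence 3 (ℕ.s≤s (ℕ.s≤s (ℕ.s≤s ()))) k

module RowSums where

  open Ways using (Counts; ways; ∑ᶜ; within; ways-beyond)
  open GiftExchange using (G₂-within)
  open Recurrences using (E₂-ways; E₂-recurrence)
  import Data.Nat as ℕ
  import Data.Nat.Properties as ℕ
  import Data.Nat.Tactic.RingSolver as ℕ-Ring
  open import Data.Nat using (zero; suc; _<_; s≤s; z≤n)
  open import Data.Integer using (ℤ; +_; _+_; _-_; _*_; -_)
  open import Data.Integer.Properties using (pos-+; m-n≡m⊖n; ⊖-<; +-assoc; +-identityˡ; +-identityʳ; *-zeroʳ)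
  open import Data.Integer.Tactic.RingSolver using (solve-∀)
  open import Function using (_∘_)
  open import Relation.Binary.PropositionalEquality using (sym; cong; cong₂; module ≡-Reasoning)

  ∑< : ℕ → (ℕ → ℤ) → ℤ
  ∑< zero    g = + 0
  ∑< (suc K) g = g 0 + ∑< K (g ∘ suc)

  ∑<-cong : ∀ K {f g} → (∀ j → f j ≡ g j) → ∑< K f ≡ ∑< K g
  ∑<-cong zero    eq = refl
  ∑<-cong (suc K) eq = cong₂ _+_ (eq 0) (∑<-cong K (eq ∘ suc))

  ∑<-split : ∀ p q g → ∑< (p ℕ.+ q) g ≡ ∑< p g + ∑< q (λ j → g (p ℕ.+ j))
  ∑<-split zero    q g = sym (+-identityˡ _)
  ∑<-split (suc p) q g = trans (cong (_+_ (g 0)) (∑<-split p q (g ∘ suc))) (sym (+-assoc (g 0) _ _))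

  ∑<-zero : ∀ K {g} → (∀ j → j < K → g j ≡ + 0) → ∑< K g ≡ + 0
  ∑<-zero zero    z = refl
  ∑<-zero (suc K) z = cong₂ _+_ (z 0 (s≤s z≤n)) (∑<-zero K (λ j j<K → z (suc j) (s≤s j<K)))

  ∑<-*ˡ : ∀ K c f → ∑< K (λ j → c * f j) ≡ c * ∑< K f
  ∑<-*ˡ zero    c f = sym (*-zeroʳ c)
  ∑<-*ˡ (suc K) c f = trans (cong (_+_ (c * f 0)) (∑<-*ˡ K c (f ∘ suc))) (distrib c (f 0) _)
    where
    distrib : ∀ c a s → c * a + c * s ≡ c * (a + s)
    distrib = solve-∀

  ∑ᶜ-∑< : ∀ F (f : ℕ → Counts) s → + ∑ᶜ F f s ≡ ∑< F (λ j → + f j s)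
  ∑ᶜ-∑< zero    f s = refl
  ∑ᶜ-∑< (suc F) f s = trans (pos-+ (f 0 s) _) (cong (_+_ (+ f 0 s)) (∑ᶜ-∑< F (f ∘ suc) s))

  ∑<-ways-truncate : ∀ a d →
    ∑< (suc (3 ℕ.* a) ℕ.+ d) (λ j → + ways j (a , 0 , 0)) ≡ ∑< (suc (3 ℕ.* a)) (λ j → + ways j (a , 0 , 0))
  ∑<-ways-truncate a d = begin
    ∑< (suc (3 ℕ.* a) ℕ.+ d) w                                 ≡⟨ ∑<-split (suc (3 ℕ.* a)) d w ⟩
    ∑< (suc (3 ℕ.* a)) w + ∑< d (λ j → w (suc (3 ℕ.* a) ℕ.+ j)) ≡⟨ cong (_+_ (∑< (suc (3 ℕ.* a)) w)) (∑<-zero d beyond) ⟩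
    ∑< (suc (3 ℕ.* a)) w + + 0                                  ≡⟨ +-identityʳ _ ⟩
    ∑< (suc (3 ℕ.* a)) w                                        ∎
    where
    open ≡-Reasoning
    w : ℕ → ℤ
    w j = + ways j (a , 0 , 0)
    beyond : ∀ j → j < d → w (suc (3 ℕ.* a) ℕ.+ j) ≡ + 0
    beyond j _ = cong +_ (ways-beyond (suc (3 ℕ.* a) ℕ.+ j) (a , 0 , 0) (s≤s (ℕ.m≤m+n (3 ℕ.* a) j)))

  E₂-rowSum : ∀ a d → ∑< (suc (3 ℕ.* a ℕ.+ d)) (λ j → E₂ (+ a) (+ j)) ≡ + G₂ a
  E₂-rowSum a d = begin
    ∑< (suc (3 ℕ.* a ℕ.+ d)) (λ j → E₂ (+ a) (+ j))         ≡⟨ ∑<-cong (suc (3 ℕ.* a ℕ.+ d)) (E₂-ways a) ⟩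
    ∑< (suc (3 ℕ.* a) ℕ.+ d) w                             ≡⟨ ∑<-ways-truncate a d ⟩
    ∑< (suc (3 ℕ.* a)) w                                   ≡⟨ ∑<-ways-truncate a 2 ⟨
    ∑< (suc (3 ℕ.* a) ℕ.+ 2) w                             ≡⟨ cong (λ K → ∑< K w) (fuel a) ⟨
    ∑< (suc a ℕ.* 3) w                                     ≡⟨ ∑ᶜ-∑< (suc a ℕ.* 3) ways (a , 0 , 0) ⟨
    + within (suc a ℕ.* 3) (a , 0 , 0)                     ≡⟨ cong +_ (G₂-within a) ⟨
    + G₂ a                                                 ∎
    where
    open ≡-Reasoning
    w : ℕ → ℤ
    w j = + ways j (a , 0 , 0)
    fuel : ∀ a → suc a ℕ.* 3 ≡ suc (3 ℕ.* a) ℕ.+ 2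
    fuel = ℕ-Ring.solve-∀

  E₂-negative : ∀ a {j s} → j < s → E₂ (+ a) (+ j - + s) ≡ + 0
  E₂-negative a {j} {s} j<s =
    trans (cong (E₂ (+ a)) (trans (m-n≡m⊖n j s) (⊖-< j<s))) (vanish (s ℕ.∸ j) (ℕ.m<n⇒0<n∸m j<s))
    where
    vanish : ∀ t → 0 < t → E₂ (+ a) (- + t) ≡ + 0
    vanish (suc t) _ = refl

  E₂-rowSum-shifted : ∀ i a s {d} → s ℕ.+ d ≡ 3 ℕ.* i ℕ.+ 2 →
    ∑< (suc (3 ℕ.* (i ℕ.+ a) ℕ.+ 2)) (λ j → E₂ (+ a) (+ j - + s)) ≡ + G₂ a
  E₂-rowSum-shifted i a s {d} budget = begin
    ∑< (suc (3 ℕ.* (i ℕ.+ a) ℕ.+ 2)) g                  ≡⟨ cong (λ K → ∑< K g) length ⟩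
    ∑< (s ℕ.+ suc (3 ℕ.* a ℕ.+ d)) g                   ≡⟨ ∑<-split s (suc (3 ℕ.* a ℕ.+ d)) g ⟩
    ∑< s g + ∑< (suc (3 ℕ.* a ℕ.+ d)) (λ j → g (s ℕ.+ j))
      ≡⟨ cong₂ _+_ (∑<-zero s (λ j → E₂-negative a))
                   (∑<-cong (suc (3 ℕ.* a ℕ.+ d)) (λ j → cong (E₂ (+ a)) (unshift j))) ⟩
    + 0 + ∑< (suc (3 ℕ.* a ℕ.+ d)) (λ j → E₂ (+ a) (+ j)) ≡⟨ +-identityˡ _ ⟩
    ∑< (suc (3 ℕ.* a ℕ.+ d)) (λ j → E₂ (+ a) (+ j))       ≡⟨ E₂-rowSum a d ⟩
    + G₂ a                                               ∎
    where
    open ≡-Reasoning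
    g : ℕ → ℤ
    g j = E₂ (+ a) (+ j - + s)
    length : suc (3 ℕ.* (i ℕ.+ a) ℕ.+ 2) ≡ s ℕ.+ suc (3 ℕ.* a ℕ.+ d)
    length = trans (expand i a) (trans (cong (λ t → suc (3 ℕ.* a ℕ.+ t)) (sym budget)) (regroup a s d))
      where
      expand : ∀ i a → suc (3 ℕ.* (i ℕ.+ a) ℕ.+ 2) ≡ suc (3 ℕ.* a ℕ.+ (3 ℕ.* i ℕ.+ 2))
      expand = ℕ-Ring.solve-∀
      regroup : ∀ a s d → suc (3 ℕ.* a ℕ.+ (s ℕ.+ d)) ≡ s ℕ.+ suc (3 ℕ.* a ℕ.+ d)
      regroup = ℕ-Ring.solve-∀
    unshift : ∀ j → + (s ℕ.+ j) - + s ≡ + j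
    unshift j = trans (cong (_- + s) (pos-+ s j)) (cancel (+ s) (+ j))
      where
      cancel : ∀ x y → x + y - x ≡ y
      cancel = solve-∀

  ∑<-linear : ∀ K (c₁ c₂ c₃ c₄ c₅ c₆ c₇ c₈ : ℤ) (f₁ f₂ f₃ f₄ f₅ f₆ f₇ f₈ : ℕ → ℤ) →
    ∑< K (λ j → c₁ * f₁ j - c₂ * f₂ j + c₃ * f₃ j + c₄ * f₄ j - c₅ * f₅ j + c₆ * f₆ j + c₇ * f₇ j + c₈ * f₈ j) ≡
      c₁ * ∑< K f₁ - c₂ * ∑< K f₂ + c₃ * ∑< K f₃ + c₄ * ∑< K f₄
    - c₅ * ∑< K f₅ + c₆ * ∑< K f₆ + c₇ * ∑< K f₇ + c₈ * ∑< K f₈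
  ∑<-linear zero    c₁ c₂ c₃ c₄ c₅ c₆ c₇ c₈ f₁ f₂ f₃ f₄ f₅ f₆ f₇ f₈ = vanish c₁ c₂ c₃ c₄ c₅ c₆ c₇ c₈
    where
    vanish : ∀ c₁ c₂ c₃ c₄ c₅ c₆ c₇ c₈ →
      + 0 ≡ c₁ * + 0 - c₂ * + 0 + c₃ * + 0 + c₄ * + 0 - c₅ * + 0 + c₆ * + 0 + c₇ * + 0 + c₈ * + 0
    vanish = solve-∀
  ∑<-linear (suc K) c₁ c₂ c₃ c₄ c₅ c₆ c₇ c₈ f₁ f₂ f₃ f₄ f₅ f₆ f₇ f₈ =
    trans (cong (_+_ (c₁ * f₁ 0 - c₂ * f₂ 0 + c₃ * f₃ 0 + c₄ * f₄ 0 - c₅ * f₅ 0 + c₆ * f₆ 0 + c₇ * f₇ 0 + c₈ * f₈ 0))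
                (∑<-linear K c₁ c₂ c₃ c₄ c₅ c₆ c₇ c₈
                   (f₁ ∘ suc) (f₂ ∘ suc) (f₃ ∘ suc) (f₄ ∘ suc) (f₅ ∘ suc) (f₆ ∘ suc) (f₇ ∘ suc) (f₈ ∘ suc)))
          (distrib c₁ c₂ c₃ c₄ c₅ c₆ c₇ c₈ (f₁ 0) (f₂ 0) (f₃ 0) (f₄ 0) (f₅ 0) (f₆ 0) (f₇ 0) (f₈ 0) _ _ _ _ _ _ _ _)
    where
    distrib : ∀ c₁ c₂ c₃ c₄ c₅ c₆ c₇ c₈ a₁ a₂ a₃ a₄ a₅ a₆ a₇ a₈ s₁ s₂ s₃ s₄ s₅ s₆ s₇ s₈ →
      c₁ * a₁ - c₂ * a₂ + c₃ * a₃ + c₄ * a₄ - c₅ * a₅ + c₆ * a₆ + c₇ * a₇ + c₈ * a₈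
        + (c₁ * s₁ - c₂ * s₂ + c₃ * s₃ + c₄ * s₄ - c₅ * s₅ + c₆ * s₆ + c₇ * s₇ + c₈ * s₈) ≡
      c₁ * (a₁ + s₁) - c₂ * (a₂ + s₂) + c₃ * (a₃ + s₃) + c₄ * (a₄ + s₄) - c₅ * (a₅ + s₅)
        + c₆ * (a₆ + s₆) + c₇ * (a₇ + s₇) + c₈ * (a₈ + s₈)
    distrib = solve-∀

  regroup : ∀ (n : ℤ) {S₁ S₂ S₃ S₄ S₅ S₆ S₇ S₈ g₁ g₂ g₃ g₄} →
    S₁ ≡ g₁ → S₂ ≡ g₁ → S₃ ≡ g₂ → S₄ ≡ g₂ → S₅ ≡ g₂ → S₆ ≡ g₃ → S₇ ≡ g₃ → S₈ ≡ g₄ →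
      (+ 9 * n * n - + 9 * n + + 2) * S₁ - + 5 * S₂ + (+ 9 * n * n - + 36 * n + + 35) * S₃ + + 12 * (n - + 1) * S₄
    - + 3 * S₅ + + 6 * (+ 2 * n - + 5) * S₆ + + 5 * S₇ + + 5 * S₈
    ≡ (+ 9 * n * n - + 9 * n - + 3) * g₁ + (+ 9 * n * n - + 24 * n + + 20) * g₂ + (+ 12 * n - + 25) * g₃ + + 5 * g₄
  regroup n refl refl refl refl refl refl refl refl = collect n _ _ _ _
    where
    collect : ∀ n g₁ g₂ g₃ g₄ →
        (+ 9 * n * n - + 9 * n + + 2) * g₁ - + 5 * g₁ + (+ 9 * n * n - + 36 * n + + 35) * g₂ + + 12 * (n - + 1) * g₂
      - + 3 * g₂ + + 6 * (+ 2 * n - + 5) * g₃ + + 5 * g₃ + + 5 * g₄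
      ≡ (+ 9 * n * n - + 9 * n - + 3) * g₁ + (+ 9 * n * n - + 24 * n + + 20) * g₂ + (+ 12 * n - + 25) * g₃ + + 5 * g₄
    collect = solve-∀

  G₂-recurrence : (n : ℕ) → 4 ℕ.≤ n →
    + 2 * + G₂ n ≡
        (+ 9 * + n * + n - + 9 * + n - + 3) * + G₂ (n ℕ.∸ 1)
      + (+ 9 * + n * + n - + 24 * + n + + 20) * + G₂ (n ℕ.∸ 2)
      + (+ 12 * + n - + 25) * + G₂ (n ℕ.∸ 3)
      + + 5 * + G₂ (n ℕ.∸ 4)
  G₂-recurrence n@(suc (suc (suc (suc m)))) n≥4 = begin
    + 2 * + G₂ n                                ≡⟨ cong (+ 2 *_) (E₂-rowSum n 2) ⟨
    + 2 * ∑< K (λ j → E₂ (+ n) (+ j))           ≡⟨ ∑<-*ˡ K (+ 2) (λ j → E₂ (+ n) (+ j)) ⟨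
    ∑< K (λ j → + 2 * E₂ (+ n) (+ j))           ≡⟨ ∑<-cong K (λ j → E₂-recurrence n n≥4 (+ j)) ⟩
    ∑< K (λ j → c₁ * row 1 3 j - + 5 * row 1 1 j + c₃ * row 2 4 j + c₄ * row 2 3 j - + 3 * row 2 2 j
                + c₆ * row 3 4 j + + 5 * row 3 3 j + + 5 * row 4 4 j)
      ≡⟨ ∑<-linear K c₁ (+ 5) c₃ c₄ (+ 3) c₆ (+ 5) (+ 5)
           (row 1 3) (row 1 1) (row 2 4) (row 2 3) (row 2 2) (row 3 4) (row 3 3) (row 4 4) ⟩
    c₁ * ∑< K (row 1 3) - + 5 * ∑< K (row 1 1) + c₃ * ∑< K (row 2 4) + c₄ * ∑< K (row 2 3) - + 3 * ∑< K (row 2 2)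
      + c₆ * ∑< K (row 3 4) + + 5 * ∑< K (row 3 3) + + 5 * ∑< K (row 4 4)
      ≡⟨ regroup (+ n)
           (E₂-rowSum-shifted 1 (3 ℕ.+ m) 3 refl) (E₂-rowSum-shifted 1 (3 ℕ.+ m) 1 refl)
           (E₂-rowSum-shifted 2 (2 ℕ.+ m) 4 refl) (E₂-rowSum-shifted 2 (2 ℕ.+ m) 3 refl) (E₂-rowSum-shifted 2 (2 ℕ.+ m) 2 refl)
           (E₂-rowSum-shifted 3 (1 ℕ.+ m) 4 refl) (E₂-rowSum-shifted 3 (1 ℕ.+ m) 3 refl)
           (E₂-rowSum-shifted 4 m 4 refl) ⟩
    (+ 9 * + n * + n - + 9 * + n - + 3) * + G₂ (3 ℕ.+ m) + (+ 9 * + n * + n - + 24 * + n + + 20) * + G₂ (2 ℕ.+ m)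
      + (+ 12 * + n - + 25) * + G₂ (1 ℕ.+ m) + + 5 * + G₂ m ∎
    where
    open ≡-Reasoning
    K = suc (3 ℕ.* n ℕ.+ 2)
    row : ℕ → ℕ → ℕ → ℤ
    row i s j = E₂ (+ n - + i) (+ j - + s)
    c₁ = + 9 * + n * + n - + 9 * + n + + 2
    c₃ = + 9 * + n * + n - + 36 * + n + + 35
    c₄ = + 12 * (+ n - + 1)
    c₆ = + 6 * (+ 2 * + n - + 5)
  G₂-recurrence 1 (s≤s ())
  G₂-recurrence 2 (s≤s (s≤s ()))
  G₂-recurrence 3 (s≤s (s≤s (s≤s ())))

open import Data.Integer using (ℤ; +_; _+_; _-_; _*_)
open RowSums using (G₂-recurrence)
open Recurrences using (E₂-recurrence)
open GiftExchange using (G₂-within)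

theorem6 :
  ((n : ℕ) → 4 ≤ n → (k : ℤ) →
    + 2 * E₂ (+ n) k ≡
        (+ 9 * + n * + n - + 9 * + n + + 2) * E₂ (+ n - + 1) (k - + 3)
      - + 5 * E₂ (+ n - + 1) (k - + 1)
      + (+ 9 * + n * + n - + 36 * + n + + 35) * E₂ (+ n - + 2) (k - + 4)
      + + 12 * (+ n - + 1) * E₂ (+ n - + 2) (k - + 3)
      - + 3 * E₂ (+ n - + 2) (k - + 2)
      + + 6 * (+ 2 * + n - + 5) * E₂ (+ n - + 3) (k - + 4)
      + + 5 * E₂ (+ n - + 3) (k - + 3)
      + + 5 * E₂ (+ n - + 4) (k - + 4))
  ×
  ((n : ℕ) → 4 ≤ n →
    + 2 * + G₂ n ≡
        (+ 9 * + n * + n - + 9 * + n - + 3) * + G₂ (n ∸ 1)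
      + (+ 9 * + n * + n - + 24 * + n + + 20) * + G₂ (n ∸ 2)
      + (+ 12 * + n - + 25) * + G₂ (n ∸ 3)
      + + 5 * + G₂ (n ∸ 4))
  ×
  (G₂ 0 ≡ 1) × (G₂ 1 ≡ 3) × (G₂ 2 ≡ 31) × (G₂ 3 ≡ 842)
theorem6 =
  E₂-recurrence , G₂-recurrence ,
  trans (G₂-within 0) refl , trans (G₂-within 1) refl , trans (G₂-within 2) refl , trans (G₂-within 3) refl
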